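{- Let $k,t\in\mathbb{N}$. Let $G$ be a $K_{t,t}$-free graph and let $\mathcal{P}$ be a partition of $V(G)$. Then there exists a set $S\subseteq V(G)$ with $|S|\le |\mathcal{P}|\cdot t^2$ such that for every $\mathcal{P}$-flip $G'$ of $G$ we have $$\operatorname{dist}_{G'}(u,v)\le 3\qquad\text{for all edges } uv\in E(G\setminus S).$$ In particular, for every $\mathcal{P}$-flip $G'$ of $G$, $$\operatorname{dist}_{G\setminus S}(u,v)\ge \tfrac13\operatorname{dist}_{G'}(u,v)\qquad\text{for all } u,v\in V(G)\setminus S.$$
   Context: Graphs are finite, simple and undirected. A graph is $K_{t,t}$-free if it has no subgraph (not necessarily induced) isomorphic to the complete bipartite graph $K_{t,t}$. For $S\subseteq V(G)$, $G\setminus S$ is the graph obtained from $G$ by deleting the vertices of $S$. Distances are shortest-path distances (equal to $\infty$ between different connected components). For $A,B\subseteq V(G)$, flipping the pair $(A,B)$ in $G$ yields the graph $H$ on $V(G)$ in which, for distinct $u,v$, $uv\in E(H)$ iff $uv\in E(G)\,\triangle\,\{ab: a\in A, b\in B\}$. For a partition $\mathcal{P}$ of $V(G)$, a $\mathcal{P}$-flip of $G$ is any graph obtained from $G$ by flipping some collection of pairs $(A,B)$ with $A,B\in\mathcal{P}$ (possibly $A=B$). -}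

module Defs where

open import Data.Nat using (ℕ; zero; suc; _≤_)
open import Data.Bool using (Bool; true; false; _xor_; _∧_; _∨_; not; if_then_else_)
open import Data.Fin using (Fin; _≟_)
open import Data.Fin.Subset using (Subset)
open import Data.Vec using (lookup)
open import Data.List using (List; foldr)
open import Data.Product using (_×_; _,_; ∃; Σ)
open import Relation.Nullary using (¬_; does)
open import Relation.Binary.PropositionalEquality using (_≡_)

Adj : ℕ → Set
Adj n = Fin n → Fin n → Bool

record Graph (n : ℕ) : Set where
  field
    adj    : Adj n
    sym    : ∀ u v → adj u v ≡ adj v u
    irrefl : ∀ v → adj v v ≡ false
open Graph public

record Partition (n : ℕ) : Set where
  field
    size : ℕ
    part : Fin n → Fin size
    nonempty : ∀ (i : Fin size) → ∃ λ v → part v ≡ i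
open Partition public

KttFree : ∀ {n} → ℕ → Graph n → Set
KttFree {n} t G =
  ¬ (Σ (Fin t → Fin n) λ a → Σ (Fin t → Fin n) λ b →
       (∀ i j → a i ≡ a j → i ≡ j) ×
       (∀ i j → b i ≡ b j → i ≡ j) ×
       (∀ i j → ¬ (a i ≡ b j)) ×
       (∀ i j → adj G (a i) (b j) ≡ true))

inPart : ∀ {n} (P : Partition n) → Fin (size P) → Fin n → Bool
inPart P A v = does (part P v ≟ A)

flipPair : ∀ {n} (P : Partition n) → Fin (size P) × Fin (size P) → Adj n → Adj n
flipPair P (A , B) E u v =
  if does (u ≟ v) then E u v
  else (E u v xor ((inPart P A u ∧ inPart P B v) ∨ (inPart P B u ∧ inPart P A v)))

-- The P-flip obtained by flipping a (finite) collection of pairs of parts.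
flips : ∀ {n} (P : Partition n) → List (Fin (size P) × Fin (size P)) → Adj n → Adj n
flips P L E = foldr (flipPair P) E L

deleteAdj : ∀ {n} → Adj n → Subset n → Adj n
deleteAdj E S u v = E u v ∧ not (lookup S u) ∧ not (lookup S v)

data Walk {n} (E : Adj n) : Fin n → Fin n → ℕ → Set where
  here : ∀ {u} → Walk E u u zero
  step : ∀ {u w v k} → E u w ≡ true → Walk E w v k → Walk E u v (suc k)

-- dist_E(u , v) ≤ d  (shortest-path distance; ∞ if no walk).
DistLe : ∀ {n} → Adj n → Fin n → Fin n → ℕ → Set
DistLe E u v d = ∃ λ k → k ≤ d × Walk E u v k

module Submission where

-- Let S consist of every part of P with at most t² vertices together with, for every larger part B,
-- the vertices having fewer than t non-neighbours in B (the B-poor vertices).  If uv is an edge of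
-- G ∖ S, then u has a set X of t non-neighbours in the part of v, and v a set Y of t non-neighbours in
-- the part of u.  A flip either keeps uv or toggles the pair of parts of u and v; in the latter case u
-- becomes adjacent to X and v to Y, so either X and Y meet (a path of length 2), or some x ∈ X and
-- y ∈ Y are non-adjacent in G and hence adjacent after the flip (length 3), or X and Y span a K_{t,t}.
-- Distance at most 3 across every edge of G ∖ S bounds all distances.
--
-- The bound on |S| rests on a part B with |B| > t² having at most t² poor vertices.  If t of them
-- have at most one inside B, each misses at most t − 1 vertices of B, so they have at least
-- |B| − 1 − t(t − 1) ≥ t common neighbours in B: a K_{t,t}.  Otherwise at least t² − t + 3 poor
-- vertices lie inside B, where the complement of G has maximum degree below t.  Picking t of them one
-- at a time, along a complement edge whenever possible, keeps their complement neighbourhood small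
-- enough to leave t vertices adjacent to all of them: again a K_{t,t}.

open import Defs hiding (sym)
open import Level using (0ℓ)
open import Data.Nat using (ℕ; zero; suc; pred; _+_; _*_; _∸_; _^_; _≤_; _<_; z≤n; s≤s; _≤?_; _<?_)
open import Data.Nat.Properties
  using (≤-refl; ≤-reflexive; ≤-trans; ≤-antisym; n≤1+n; m≤n⇒m≤1+n; m≤m+n; m≤n+m∸n; n≤0⇒n≡0;
         ≰⇒>; ≮⇒≥; <⇒≱; <⇒≤pred; +-comm; +-suc; *-suc; *-identityʳ;
         +-mono-≤; +-monoˡ-≤; +-monoʳ-≤; *-monoʳ-≤; +-cancelˡ-≤; +-cancelʳ-≤; module ≤-Reasoning)
open import Data.Nat.Tactic.RingSolver using (solve-∀)
open import Data.Bool using (Bool; true; false; not; _∧_; _∨_; _xor_; if_then_else_)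
import Data.Bool as Bool
open import Data.Bool.Properties using (¬-not; ∧-comm; ∨-comm; xor-assoc; xor-identityʳ; xor-inverseˡ)
open import Data.Fin using (Fin; zero; suc; _≟_)
open import Data.Fin.Properties using (any?; all?; suc-injective) renaming (0≢1+n to zero≢suc)
open import Data.Fin.Subset using (Subset; ∣_∣; _∉_)
open import Data.Vec using (tabulate)
open import Data.Vec.Properties using (lookup∘tabulate)
open import Data.List using (List; []; _∷_)
open import Data.Empty using (⊥; ⊥-elim)
open import Data.Product using (_×_; _,_; Σ; ∃; ∃₂; proj₁; proj₂)
open import Data.Sum using (_⊎_; inj₁; inj₂; [_,_]′)
open import Function using (_∘_; id)
open import Function.Definitions using (Injective)
open import Relation.Nullary using (¬_; Dec; yes; no; does; contradiction; ¬?; _×-dec_; _⊎-dec_)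
open import Relation.Unary using (Pred; Decidable; ∅; _∈_; _⊆_; _∪_; _∩_; ∁; ⋃; Empty; Satisfiable)
open import Relation.Unary.Properties using (∅?; _∪?_; _∩?_; ∁?)
open import Relation.Binary.PropositionalEquality using (_≡_; _≢_; refl; sym; trans; cong; cong₂; subst)

private variable
  n m c : ℕ
  P Q R : Pred (Fin n) 0ℓ

-- Counting decidable subsets of Fin n

count : ∀ {n} {P : Pred (Fin n) 0ℓ} → Decidable P → ℕ
count {zero} P? = 0
count {suc n} P? = (if does (P? zero) then suc else id) (count (P? ∘ suc))

count-mono : ∀ {n} {P Q : Pred (Fin n) 0ℓ} → P ⊆ Q → (P? : Decidable P) (Q? : Decidable Q) →
             count P? ≤ count Q?
count-mono {zero} _ _ _ = z≤n
count-mono {suc n} P⊆Q P? Q? with P? zero | Q? zero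
... | yes _ | yes _ = s≤s (count-mono P⊆Q (P? ∘ suc) (Q? ∘ suc))
... | yes p | no ¬q = contradiction (P⊆Q p) ¬q
... | no _  | yes _ = m≤n⇒m≤1+n (count-mono P⊆Q (P? ∘ suc) (Q? ∘ suc))
... | no _  | no _  = count-mono P⊆Q (P? ∘ suc) (Q? ∘ suc)

count-∪ : ∀ {n} {P Q : Pred (Fin n) 0ℓ} (P? : Decidable P) (Q? : Decidable Q) →
          count (P? ∪? Q?) ≤ count P? + count Q?
count-∪ {zero} _ _ = z≤n
count-∪ {suc n} P? Q? with P? zero | Q? zero
... | yes _ | yes _ = s≤s (≤-trans (count-∪ (P? ∘ suc) (Q? ∘ suc))
                                   (+-monoʳ-≤ (count (P? ∘ suc)) (n≤1+n _)))
... | yes _ | no _  = s≤s (count-∪ (P? ∘ suc) (Q? ∘ suc))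
... | no _  | yes _ = ≤-trans (s≤s (count-∪ (P? ∘ suc) (Q? ∘ suc))) (≤-reflexive (sym (+-suc _ _)))
... | no _  | no _  = count-∪ (P? ∘ suc) (Q? ∘ suc)

count-⊆-∪ : P ⊆ Q ∪ R → (P? : Decidable P) (Q? : Decidable Q) (R? : Decidable R) →
            count P? ≤ count Q? + count R?
count-⊆-∪ P⊆Q∪R P? Q? R? = ≤-trans (count-mono P⊆Q∪R P? (Q? ∪? R?)) (count-∪ Q? R?)

count-split : (P? : Decidable P) (Q? : Decidable Q) → count P? ≤ count (P? ∩? Q?) + count (P? ∩? ∁? Q?)
count-split {P = P} {Q = Q} P? Q? = count-⊆-∪ split P? (P? ∩? Q?) (P? ∩? ∁? Q?)
  where split : P ⊆ P ∩ Q ∪ P ∩ ∁ Q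
        split {x} x∈P with Q? x
        ... | yes x∈Q = inj₁ (x∈P , x∈Q)
        ... | no x∉Q  = inj₂ (x∈P , x∉Q)

count-< : ∀ {n} {P Q : Pred (Fin n) 0ℓ} {x} → P ⊆ Q → x ∈ Q → ¬ x ∈ P →
          (P? : Decidable P) (Q? : Decidable Q) → count P? < count Q?
count-< {suc n} {x = zero} P⊆Q q ¬p P? Q? with P? zero | Q? zero
... | yes p | _     = contradiction p ¬p
... | no _  | yes _ = s≤s (count-mono P⊆Q (P? ∘ suc) (Q? ∘ suc))
... | no _  | no ¬q = contradiction q ¬q
count-< {suc n} {x = suc x} P⊆Q q ¬p P? Q? with P? zero | Q? zero
... | yes _ | yes _ = s≤s (count-< P⊆Q q ¬p (P? ∘ suc) (Q? ∘ suc))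
... | yes p | no ¬q = contradiction (P⊆Q p) ¬q
... | no _  | yes _ = m≤n⇒m≤1+n (count-< P⊆Q q ¬p (P? ∘ suc) (Q? ∘ suc))
... | no _  | no _  = count-< P⊆Q q ¬p (P? ∘ suc) (Q? ∘ suc)

count-empty : ∀ {n} {P : Pred (Fin n) 0ℓ} → Empty P → (P? : Decidable P) → count P? ≡ 0
count-empty {zero} _ _ = refl
count-empty {suc n} ∅ P? with P? zero
... | yes p = contradiction p (∅ zero)
... | no _  = count-empty (∅ ∘ suc) (P? ∘ suc)

count-subsingleton : ∀ {n} {P : Pred (Fin n) 0ℓ} → (∀ {x y} → x ∈ P → y ∈ P → x ≡ y) →
                     (P? : Decidable P) → count P? ≤ 1
count-subsingleton {zero} _ _ = z≤n
count-subsingleton {suc n} unique P? with P? zero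
... | yes p = s≤s (≤-reflexive (count-empty (λ x q → zero≢suc (unique p q)) (P? ∘ suc)))
... | no _  = count-subsingleton (λ p q → suc-injective (unique p q)) (P? ∘ suc)

count-satisfiable : ∀ {n} {P : Pred (Fin n) 0ℓ} (P? : Decidable P) → 0 < count P? → Satisfiable P
count-satisfiable {suc n} P? pos with P? zero
... | yes p = zero , p
... | no _  = let (x , p) = count-satisfiable (P? ∘ suc) pos in suc x , p

count-insert : ∀ {n} {P : Pred (Fin n) 0ℓ} {x} (P? : Decidable P) → ¬ x ∈ P →
               count (P? ∪? (_≟ x)) ≡ suc (count P?)
count-insert {P = P} {x} P? x∉P = ≤-antisym
  (≤-trans (count-∪ P? (_≟ x))
    (≤-trans (+-monoʳ-≤ (count P?) (count-subsingleton (λ y≡x z≡x → trans y≡x (sym z≡x)) (_≟ x)))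
      (≤-reflexive (+-comm (count P?) 1))))
  (count-< inj₁ (inj₂ refl) x∉P P? (P? ∪? (_≟ x)))

⋃? : {P : Fin m → Pred (Fin n) 0ℓ} → (∀ i → Decidable (P i)) → Decidable (⋃ (Fin m) P)
⋃? P? x = any? λ i → P? i x

count-⋃ : ∀ {m} {P : Fin m → Pred (Fin n) 0ℓ} (P? : ∀ i → Decidable (P i)) →
          (∀ i → count (P? i) ≤ c) → count (⋃? P?) ≤ m * c
count-⋃ {m = zero} P? _ = ≤-reflexive (count-empty (λ _ ()) (⋃? P?))
count-⋃ {m = suc m} {P = P} P? bound =
  ≤-trans (count-⊆-∪ split (⋃? P?) (P? zero) (⋃? (P? ∘ suc)))
          (+-mono-≤ (bound zero) (count-⋃ (P? ∘ suc) (bound ∘ suc)))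
  where
  split : ⋃ (Fin (suc m)) P ⊆ P zero ∪ ⋃ (Fin m) (P ∘ suc)
  split (zero , p)  = inj₁ p
  split (suc i , p) = inj₂ (i , p)

choose : ∀ {n} {P : Pred (Fin n) 0ℓ} (P? : Decidable P) k → k ≤ count P? →
         Σ (Fin k → Fin n) λ f → Injective _≡_ _≡_ f × (∀ i → f i ∈ P)
choose {zero} P? zero _ = (λ ()) , (λ { {()} }) , (λ ())
choose {suc n} P? k k≤ with P? zero
... | no _ = let (f , f-inj , f∈P) = choose (P? ∘ suc) k k≤ in
             suc ∘ f , f-inj ∘ suc-injective , f∈P
choose {suc n} P? zero _ | yes _ = (λ ()) , (λ { {()} }) , (λ ())
choose {suc n} {P} P? (suc k) (s≤s k≤) | yes p =
  let (f , f-inj , f∈P) = choose (P? ∘ suc) k k≤ in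
  g f , g-injective f-inj , g∈P f∈P
  where
  g : (Fin k → Fin n) → Fin (suc k) → Fin (suc n)
  g f zero    = zero
  g f (suc i) = suc (f i)
  g-injective : ∀ {f} → Injective _≡_ _≡_ f → Injective _≡_ _≡_ (g f)
  g-injective f-inj {zero}  {zero}  _  = refl
  g-injective f-inj {suc i} {suc j} eq = cong suc (f-inj (suc-injective eq))
  g∈P : ∀ {f} → (∀ i → suc (f i) ∈ P) → ∀ i → g f i ∈ P
  g∈P f∈P zero    = p
  g∈P f∈P (suc i) = f∈P i

∣tabulate∣≡count : ∀ {n} {P : Pred (Fin n) 0ℓ} (P? : Decidable P) →
                   ∣ tabulate (does ∘ P?) ∣ ≡ count P?
∣tabulate∣≡count {zero} P? = refl
∣tabulate∣≡count {suc n} P? with does (P? zero)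
... | true  = cong suc (∣tabulate∣≡count (P? ∘ suc))
... | false = ∣tabulate∣≡count (P? ∘ suc)

_++ʷ_ : ∀ {E : Adj n} {u w v k l} → Walk E u w k → Walk E w v l → Walk E u v (k + l)
here       ++ʷ q = q
step e p   ++ʷ q = step e (p ++ʷ q)

distLe-stretch : ∀ {E F : Adj n} c → (∀ {u v} → E u v ≡ true → DistLe F u v c) →
                 ∀ {u v k} → Walk E u v k → DistLe F u v (c * k)
distLe-stretch c short here = 0 , z≤n , here
distLe-stretch c short {k = suc k} (step e p) =
  let (j , j≤c , q) = short e
      (j′ , j′≤ck , q′) = distLe-stretch c short p
  in j + j′ , ≤-trans (+-mono-≤ j≤c j′≤ck) (≤-reflexive (sym (*-suc c k))) , q ++ʷ q′

covers : Fin m × Fin m → Fin m → Fin m → Bool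
covers (A , B) a b = (does (a ≟ A) ∧ does (b ≟ B)) ∨ (does (a ≟ B) ∧ does (b ≟ A))

flipped : List (Fin m × Fin m) → Fin m → Fin m → Bool
flipped []       a b = false
flipped (AB ∷ L) a b = flipped L a b xor covers AB a b

covers-sym : (AB : Fin m × Fin m) (a b : Fin m) → covers AB a b ≡ covers AB b a
covers-sym (A , B) a b
  rewrite ∧-comm (does (b ≟ B)) (does (a ≟ A)) | ∧-comm (does (b ≟ A)) (does (a ≟ B)) =
  ∨-comm (does (a ≟ A) ∧ does (b ≟ B)) _

flipped-sym : (L : List (Fin m × Fin m)) (a b : Fin m) → flipped L a b ≡ flipped L b a
flipped-sym []       a b = refl
flipped-sym (AB ∷ L) a b = cong₂ _xor_ (flipped-sym L a b) (covers-sym AB a b)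

module _ (P : Partition n) (E : Adj n) where

  flips-apart : ∀ L {u v} → u ≢ v → flips P L E u v ≡ E u v xor flipped L (part P u) (part P v)
  flips-apart []       _   = sym (xor-identityʳ _)
  flips-apart (AB ∷ L) {u} {v} u≢v with u ≟ v
  ... | yes u≡v = contradiction u≡v u≢v
  ... | no _ rewrite flips-apart L u≢v = xor-assoc (E u v) _ _

  flips-adjacent : ∀ L {u v} → u ≢ v → E u v ≡ not (flipped L (part P u) (part P v)) →
                   flips P L E u v ≡ true
  flips-adjacent L {u} {v} u≢v E≡ =
    trans (flips-apart L u≢v) (trans (cong (_xor _) E≡) (xor-inverseˡ (flipped L (part P u) (part P v))))

NonAdj : Graph n → Fin n → Pred (Fin n) 0ℓ
NonAdj G u x = x ≢ u × adj G u x ≡ false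

module _ (G : Graph n) where

  nonAdj? : ∀ u → Decidable (NonAdj G u)
  nonAdj? u x = ¬? (x ≟ u) ×-dec (adj G u x Bool.≟ false)

  NonAdj-sym : ∀ {u x} → NonAdj G u x → NonAdj G x u
  NonAdj-sym {u} {x} (x≢u , ux) = x≢u ∘ sym , trans (Graph.sym G x u) ux

  adjacent-if-¬NonAdj : ∀ {u x} → x ≢ u → ¬ NonAdj G u x → adj G u x ≡ true
  adjacent-if-¬NonAdj x≢u ¬ux = ¬-not λ ux → ¬ux (x≢u , ux)

module _ {t} (G : Graph n) (kf : KttFree t G) where

  overlap-or-nonAdjacent : (X Y : Fin t → Fin n) → Injective _≡_ _≡_ X → Injective _≡_ _≡_ Y →
    (∃₂ λ i j → X i ≡ Y j) ⊎ (∃₂ λ i j → X i ≢ Y j × adj G (X i) (Y j) ≡ false)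
  overlap-or-nonAdjacent X Y X-inj Y-inj with any? (λ i → any? λ j → X i ≟ Y j)
  ... | yes (i , j , Xi≡Yj) = inj₁ (i , j , Xi≡Yj)
  ... | no disjoint with any? (λ i → any? λ j → adj G (X i) (Y j) Bool.≟ false)
  ...   | yes (i , j , nonAdj) = inj₂ (i , j , (λ Xi≡Yj → disjoint (i , j , Xi≡Yj)) , nonAdj)
  ...   | no complete = contradiction
          (X , Y , (λ _ _ → X-inj) , (λ _ _ → Y-inj) ,
           (λ i j Xi≡Yj → disjoint (i , j , Xi≡Yj)) , (λ i j → ¬-not λ e → complete (i , j , e)))
          kf

  few-common-neighbours : (U : Fin t → Fin n) → Injective _≡_ _≡_ U →
    {W : Pred (Fin n) 0ℓ} (W? : Decidable W) → (∀ i {x} → x ∈ W → adj G (U i) x ≡ true) → count W? < t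
  few-common-neighbours U U-inj {W} W? U→W with t ≤? count W?
  ... | no t≰ = ≰⇒> t≰
  ... | yes t≤ with choose W? t t≤
  ...   | Y , Y-inj , Y∈W with overlap-or-nonAdjacent U Y U-inj Y-inj
  ...     | inj₁ (i , j , Ui≡Yj) =
            contradiction (trans (sym (U→W i (subst W (sym Ui≡Yj) (Y∈W j)))) (irrefl G (U i))) λ ()
  ...     | inj₂ (i , j , _ , nonAdj) = contradiction (trans (sym (U→W i (Y∈W j))) nonAdj) λ ()

-- Greedy clusters in a graph of bounded degree

-- A vertex added from the boundary leaves it and has a neighbour already in the cluster, so it
-- adds at most d − 2 boundary vertices; a vertex added to a cluster without boundary adds at most d.
clusterBound : ℕ → ℕ → ℕ
clusterBound d zero    = 0
clusterBound d (suc k) = d + k * (d ∸ 2)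

module BoundedDegree {n : ℕ} {H : Fin n → Pred (Fin n) 0ℓ} (H? : ∀ u → Decidable (H u))
                     (H-sym : ∀ {u x} → H u x → H x u)
                     {Q : Pred (Fin n) 0ℓ} (Q? : Decidable Q) (d : ℕ)
                     (degree≤ : ∀ {u} → u ∈ Q → count (Q? ∩? H? u) ≤ d) where

  Boundary : Pred (Fin n) 0ℓ → Pred (Fin n) 0ℓ
  Boundary U x = x ∈ Q × ¬ x ∈ U × ∃ λ y → y ∈ U × H y x

  boundary? : {U : Pred (Fin n) 0ℓ} → Decidable U → Decidable (Boundary U)
  boundary? U? x = Q? x ×-dec ¬? (U? x) ×-dec any? (λ y → U? y ×-dec H? y x)

  record Cluster (k : ℕ) : Set₁ where
    field
      U         : Pred (Fin n) 0ℓ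
      U?        : Decidable U
      U⊆Q       : U ⊆ Q
      size≡     : count U? ≡ k
      boundary≤ : count (boundary? U?) ≤ clusterBound d k

  module _ {U : Pred (Fin n) 0ℓ} (U? : Decidable U) (U⊆Q : U ⊆ Q)
           {w} (w∈Q : w ∈ Q) (w∉U : ¬ w ∈ U) where

    private
      U′? : Decidable (U ∪ (_≡ w))
      U′? = U? ∪? (_≟ w)

      Old? : Decidable (Boundary U ∩ ∁ (_≡ w))
      Old? = boundary? U? ∩? ∁? (_≟ w)

      New? : Decidable (Q ∩ H w ∩ ∁ U)
      New? = Q? ∩? H? w ∩? ∁? U?

      boundary-insert : Boundary (U ∪ (_≡ w)) ⊆ Boundary U ∩ ∁ (_≡ w) ∪ Q ∩ H w ∩ ∁ U
      boundary-insert (x∈Q , x∉U′ , y , inj₁ y∈U , Hyx) =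
        inj₁ ((x∈Q , x∉U′ ∘ inj₁ , y , y∈U , Hyx) , x∉U′ ∘ inj₂)
      boundary-insert (x∈Q , x∉U′ , y , inj₂ refl , Hwx) = inj₂ (x∈Q , Hwx , x∉U′ ∘ inj₁)

      boundary≤Old+New : count (boundary? U′?) ≤ count Old? + count New?
      boundary≤Old+New = count-⊆-∪ boundary-insert (boundary? U′?) Old? New?

      New≤d : count New? ≤ d
      New≤d = ≤-trans (count-mono drop-∁U New? (Q? ∩? H? w)) (degree≤ w∈Q)
        where drop-∁U : Q ∩ H w ∩ ∁ U ⊆ Q ∩ H w
              drop-∁U (x∈Q , Hwx , _) = x∈Q , Hwx

      inserted : ∀ {k} → count U? ≡ k → count (boundary? U′?) ≤ clusterBound d (suc k) → Cluster (suc k)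
      inserted size≡ boundary≤ = record
        { U = U ∪ (_≡ w) ; U? = U′? ; U⊆Q = λ { (inj₁ x∈U) → U⊆Q x∈U ; (inj₂ refl) → w∈Q }
        ; size≡ = trans (count-insert U? w∉U) (cong suc size≡) ; boundary≤ = boundary≤ }

    insert-fresh : ∀ {k} → count U? ≡ k → count (boundary? U?) ≡ 0 → Cluster (suc k)
    insert-fresh {k} size≡ empty = inserted size≡ (begin
      count (boundary? U′?)       ≤⟨ boundary≤Old+New ⟩
      count Old? + count New?     ≤⟨ +-mono-≤ (count-mono proj₁ Old? (boundary? U?)) New≤d ⟩
      count (boundary? U?) + d    ≡⟨ cong (_+ d) empty ⟩
      d                           ≤⟨ m≤m+n d _ ⟩
      clusterBound d (suc k)      ∎)
      where open ≤-Reasoning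

    insert-boundary : ∀ {k} → count U? ≡ suc k → count (boundary? U?) ≤ clusterBound d (suc k) →
                      w ∈ Boundary U → Cluster (suc (suc k))
    insert-boundary {k} size≡ boundary≤ (_ , _ , y , y∈U , Hyw) = inserted size≡ (+-cancelʳ-≤ 2 _ _ (begin
      count (boundary? U′?) + 2              ≤⟨ +-monoˡ-≤ 2 boundary≤Old+New ⟩
      count Old? + count New? + 2            ≡⟨ a+b+2≡1+a+1+b (count Old?) (count New?) ⟩
      suc (count Old?) + suc (count New?)    ≤⟨ +-mono-≤ Old<Boundary (≤-trans New<QH (degree≤ w∈Q)) ⟩
      count (boundary? U?) + d               ≤⟨ +-mono-≤ boundary≤ (m≤n+m∸n d 2) ⟩
      clusterBound d (suc k) + (2 + (d ∸ 2)) ≡⟨ bound-step d (d ∸ 2) k ⟩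
      clusterBound d (suc (suc k)) + 2       ∎))
      where
      open ≤-Reasoning
      Old<Boundary : count Old? < count (boundary? U?)
      Old<Boundary =
        count-< proj₁ (w∈Q , w∉U , y , y∈U , Hyw) (λ (_ , w≢w) → w≢w refl) Old? (boundary? U?)
      New<QH : count New? < count (Q? ∩? H? w)
      New<QH = count-< (λ (x∈Q , Hwx , _) → x∈Q , Hwx) (U⊆Q y∈U , H-sym Hyw)
                       (λ (_ , _ , y∉U) → y∉U y∈U) New? (Q? ∩? H? w)
      a+b+2≡1+a+1+b : ∀ a b → a + b + 2 ≡ suc a + suc b
      a+b+2≡1+a+1+b = solve-∀
      bound-step : ∀ d e k → d + k * e + (2 + e) ≡ d + (1 + k) * e + 2
      bound-step = solve-∀

  ∅-cluster : Cluster 0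
  ∅-cluster = record
    { U = ∅ ; U? = ∅? ; U⊆Q = λ () ; size≡ = count-empty (λ _ ()) (∅? {A = Fin n})
    ; boundary≤ = ≤-reflexive (count-empty (λ { _ (_ , _ , _ , () , _) }) (boundary? ∅?)) }

  extend-at-boundary : ∀ {k} (C : Cluster k) → 0 < count (boundary? (Cluster.U? C)) → Cluster (suc k)
  extend-at-boundary {zero}  C nonempty = contradiction (≤-trans nonempty (Cluster.boundary≤ C)) λ ()
  extend-at-boundary {suc k} C nonempty with count-satisfiable (boundary? U?) nonempty
    where open Cluster C
  ... | w , w∈B@(w∈Q , w∉U , _) = insert-boundary U? U⊆Q w∈Q w∉U size≡ boundary≤ w∈B
    where open Cluster C

  extend-fresh : ∀ {k} (C : Cluster k) → suc k ≤ count Q? → count (boundary? (Cluster.U? C)) ≡ 0 →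
                 Cluster (suc k)
  extend-fresh {k} C sk≤ empty with count-satisfiable (Q? ∩? ∁? U?) fresh
    where
    open Cluster C
    fresh : 0 < count (Q? ∩? ∁? U?)
    fresh = +-cancelˡ-≤ k 1 _ (begin
      k + 1                                       ≡⟨ +-comm k 1 ⟩
      suc k                                       ≤⟨ sk≤ ⟩
      count Q?                                    ≤⟨ count-split Q? U? ⟩
      count (Q? ∩? U?) + count (Q? ∩? ∁? U?)      ≤⟨ +-monoˡ-≤ _ (count-mono proj₂ (Q? ∩? U?) U?) ⟩
      count U? + count (Q? ∩? ∁? U?)              ≡⟨ cong (_+ _) size≡ ⟩
      k + count (Q? ∩? ∁? U?)                     ∎)
      where open ≤-Reasoning
  ... | w , w∈Q , w∉U = insert-fresh U? U⊆Q w∈Q w∉U size≡ empty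
    where open Cluster C

  extend : ∀ {k} → Cluster k → suc k ≤ count Q? → Cluster (suc k)
  extend C sk≤ with 0 <? count (boundary? (Cluster.U? C))
  ... | yes nonempty = extend-at-boundary C nonempty
  ... | no empty     = extend-fresh C sk≤ (n≤0⇒n≡0 (≮⇒≥ empty))

  cluster : ∀ k → k ≤ count Q? → Cluster k
  cluster zero    _   = ∅-cluster
  cluster (suc k) sk≤ = extend (cluster k (≤-trans (n≤1+n k) sk≤)) sk≤

  module _ {k} (C : Cluster k) where
    open Cluster C

    Exterior : Pred (Fin n) 0ℓ
    Exterior = Q ∩ ∁ U ∩ ∁ (Boundary U)

    exterior? : Decidable Exterior
    exterior? = Q? ∩? ∁? U? ∩? ∁? (boundary? U?)

    count-Q≤ : count Q? ≤ k + (clusterBound d k + count exterior?)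
    count-Q≤ = begin
      count Q?
        ≤⟨ count-⊆-∪ split Q? U? (boundary? U? ∪? exterior?) ⟩
      count U? + count (boundary? U? ∪? exterior?)
        ≤⟨ +-monoʳ-≤ (count U?) (count-∪ (boundary? U?) exterior?) ⟩
      count U? + (count (boundary? U?) + count exterior?)
        ≤⟨ +-mono-≤ (≤-reflexive size≡) (+-monoˡ-≤ _ boundary≤) ⟩
      k + (clusterBound d k + count exterior?) ∎
      where
      open ≤-Reasoning
      split : Q ⊆ U ∪ Boundary U ∪ Exterior
      split {x} x∈Q with U? x | boundary? U? x
      ... | yes x∈U | _          = inj₁ x∈U
      ... | no _    | yes x∈B    = inj₂ (inj₁ x∈B)
      ... | no x∉U  | no x∉B     = inj₂ (inj₂ (x∈Q , x∉U , x∉B))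

    exterior-¬H : ∀ {x y} → x ∈ Exterior → y ∈ U → ¬ H y x
    exterior-¬H (x∈Q , x∉U , x∉B) y∈U Hyx = x∉B (x∈Q , x∉U , _ , y∈U , Hyx)

-- Poor vertices

module _ (t : ℕ) (G : Graph n) {B : Pred (Fin n) 0ℓ} (B? : Decidable B) where

  Poor : Pred (Fin n) 0ℓ
  Poor u = count (B? ∩? nonAdj? G u) < t

  poor? : Decidable Poor
  poor? u = count (B? ∩? nonAdj? G u) <? t

  Common : (Fin t → Fin n) → Pred (Fin n) 0ℓ
  Common U x = ∀ i → adj G (U i) x ≡ true

  common? : (U : Fin t → Fin n) → Decidable (Common U)
  common? U x = all? λ i → adj G (U i) x Bool.≟ true

  many-common-neighbours : t * t < count B? → (U : Fin t → Fin n) → (∀ i → U i ∈ Poor) →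
    (∀ {i j} → U i ∈ B → U j ∈ B → U i ≡ U j) → t ≤ count (B? ∩? common? U)
  many-common-neighbours t²<B U U-poor U-once = ≤-from-square (begin
    count B?
      ≤⟨ count-⊆-∪ split B? (B? ∩? common? U) (image? ∪? ⋃? nonAdjU?) ⟩
    count (B? ∩? common? U) + count (image? ∪? ⋃? nonAdjU?)
      ≤⟨ +-monoʳ-≤ _ (count-∪ image? (⋃? nonAdjU?)) ⟩
    count (B? ∩? common? U) + (count image? + count (⋃? nonAdjU?))
      ≤⟨ +-monoʳ-≤ _ (+-mono-≤ (count-subsingleton once image?) (count-⋃ nonAdjU? (<⇒≤pred ∘ U-poor))) ⟩
    count (B? ∩? common? U) + suc (t * pred t) ∎)
    where
    open ≤-Reasoning
    Image : Pred (Fin n) 0ℓ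
    Image x = ∃ λ i → x ≡ U i
    image? : Decidable (B ∩ Image)
    image? x = B? x ×-dec any? (λ i → x ≟ U i)
    nonAdjU? : ∀ i → Decidable (B ∩ NonAdj G (U i))
    nonAdjU? i = B? ∩? nonAdj? G (U i)
    once : ∀ {x y} → x ∈ B ∩ Image → y ∈ B ∩ Image → x ≡ y
    once (x∈B , i , refl) (y∈B , j , refl) = U-once x∈B y∈B
    split : B ⊆ B ∩ Common U ∪ B ∩ Image ∪ ⋃ (Fin t) (λ i → B ∩ NonAdj G (U i))
    split {x} x∈B with any? (λ i → adj G (U i) x Bool.≟ false)
    ... | no noneMissing = inj₁ (x∈B , λ i → ¬-not λ missing → noneMissing (i , missing))
    ... | yes (i , missing) with x ≟ U i
    ...   | yes x≡Ui = inj₂ (inj₁ (x∈B , i , x≡Ui))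
    ...   | no x≢Ui  = inj₂ (inj₂ (i , x∈B , x≢Ui , missing))
    ≤-from-square : count B? ≤ count (B? ∩? common? U) + suc (t * pred t) → t ≤ count (B? ∩? common? U)
    ≤-from-square B≤ = +-cancelʳ-≤ (suc (t * pred t)) t _
      (≤-trans (≤-reflexive (trans (+-suc t _) (cong suc (sym (square t))))) (≤-trans t²<B B≤))
      where square : ∀ t → t * t ≡ t + t * pred t
            square zero    = refl
            square (suc k) = *-suc (suc k) k

t+t≤t*t+3 : ∀ t → t + t ≤ t * t + 3
t+t≤t*t+3 0 = z≤n
t+t≤t*t+3 1 = s≤s (s≤s z≤n)
t+t≤t*t+3 2 = s≤s (s≤s (s≤s (s≤s z≤n)))
t+t≤t*t+3 (suc (suc (suc j))) = ≤-trans (m≤m+n _ (j * j + 4 * j + 6)) (≤-reflexive (expand j))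
  where expand : ∀ j → (3 + j) + (3 + j) + (j * j + 4 * j + 6) ≡ (3 + j) * (3 + j) + 3
        expand = solve-∀

t+t+t+clusterBound≤t*t+3 : ∀ t → t + t + t + clusterBound (pred t) t ≤ t * t + 3
t+t+t+clusterBound≤t*t+3 0 = z≤n
t+t+t+clusterBound≤t*t+3 1 = s≤s (s≤s (s≤s z≤n))
t+t+t+clusterBound≤t*t+3 2 = ≤-refl
t+t+t+clusterBound≤t*t+3 (suc (suc (suc j))) = ≤-trans (m≤m+n _ 1) (≤-reflexive (expand j))
  where expand : ∀ j → (3 + j) + (3 + j) + (3 + j) + ((2 + j) + (2 + j) * j) + 1 ≡ (3 + j) * (3 + j) + 3
        expand = solve-∀

module _ {t} (G : Graph n) (kf : KttFree t G) {B : Pred (Fin n) 0ℓ} (B? : Decidable B) where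

  private
    inside? : Decidable (Poor t G B? ∩ B)
    inside? = poor? t G B? ∩? B?

    outside? : Decidable (Poor t G B? ∩ ∁ B)
    outside? = poor? t G B? ∩? ∁? B?

    poor≤in+out : count (poor? t G B?) ≤ count inside? + count outside?
    poor≤in+out = count-split (poor? t G B?) B?

  PoorFamily : Set
  PoorFamily = Σ (Fin t → Fin n) λ U → Injective _≡_ _≡_ U × (∀ i → U i ∈ Poor t G B?) ×
                                       (∀ {i j} → U i ∈ B → U j ∈ B → U i ≡ U j)

  ¬poor-family : t * t < count B? → ¬ PoorFamily
  ¬poor-family t²<B (U , U-inj , U-poor , U-once) =
    <⇒≱ (few-common-neighbours G kf U U-inj (B? ∩? common? t G B? U) (λ i (_ , common) → common i))
        (many-common-neighbours t G B? t²<B U U-poor U-once)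

  ¬many-poor-inside : t * t + 3 ≤ count inside? + t → ⊥
  ¬many-poor-inside many = <⇒≱ (few-common-neighbours G kf X X-inj (exterior? C) X→exterior) t≤exterior
    where
    degree≤ : ∀ {u} → u ∈ Poor t G B? ∩ B → count (inside? ∩? nonAdj? G u) ≤ pred t
    degree≤ {u} (u-poor , _) =
      ≤-trans (count-mono (λ ((_ , x∈B) , ux) → x∈B , ux) (inside? ∩? nonAdj? G u) (B? ∩? nonAdj? G u))
              (<⇒≤pred u-poor)
    open BoundedDegree (nonAdj? G) (NonAdj-sym G) inside? (pred t) degree≤
    C : Cluster t
    C = cluster t (+-cancelʳ-≤ t t _ (≤-trans (t+t≤t*t+3 t) many))
    open Cluster C
    X-choice = choose U? t (≤-reflexive (sym size≡))
    X = proj₁ X-choice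
    X-inj = proj₁ (proj₂ X-choice)
    X∈U = proj₂ (proj₂ X-choice)
    X→exterior : ∀ i {x} → x ∈ Exterior C → adj G (X i) x ≡ true
    X→exterior i x∈ext@(_ , x∉U , _) =
      adjacent-if-¬NonAdj G (λ x≡Xi → x∉U (subst U (sym x≡Xi) (X∈U i))) (exterior-¬H C x∈ext (X∈U i))
    t≤exterior : t ≤ count (exterior? C)
    t≤exterior = +-cancelˡ-≤ (t + t + bound) t _ (begin
      t + t + bound + t                     ≡⟨ rotate t bound ⟩
      t + t + t + bound                     ≤⟨ t+t+t+clusterBound≤t*t+3 t ⟩
      t * t + 3                             ≤⟨ many ⟩
      count inside? + t                     ≤⟨ +-monoˡ-≤ t (count-Q≤ C) ⟩
      t + (bound + count (exterior? C)) + t ≡⟨ rearrange t bound (count (exterior? C)) ⟩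
      t + t + bound + count (exterior? C)   ∎)
      where
      open ≤-Reasoning
      bound = clusterBound (pred t) t
      rotate : ∀ t b → t + t + b + t ≡ t + t + t + b
      rotate = solve-∀
      rearrange : ∀ t b w → t + (b + w) + t ≡ t + t + b + w
      rearrange = solve-∀

  poor-family : t * t < count (poor? t G B?) → t ≤ suc (count outside?) → PoorFamily
  poor-family t²<poor t≤ with 0 <? count inside?
  ... | yes nonempty = around (count-satisfiable inside? nonempty)
    where
    around : Satisfiable (Poor t G B? ∩ B) → PoorFamily
    around (w , w-poor , w∈B) =
      let t≤R = ≤-trans t≤ (≤-reflexive (sym (count-insert outside? λ (_ , w∉B) → w∉B w∈B)))
          (U , U-inj , U∈R) = choose (outside? ∪? (_≟ w)) t t≤R
      in U , U-inj , (λ i → poor (U∈R i)) ,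
         λ {i} {j} Ui∈B Uj∈B → trans (only-w (U∈R i) Ui∈B) (sym (only-w (U∈R j) Uj∈B))
      where
      poor : ∀ {x} → x ∈ Poor t G B? ∩ ∁ B ∪ (_≡ w) → x ∈ Poor t G B?
      poor (inj₁ (x-poor , _)) = x-poor
      poor (inj₂ refl)         = w-poor
      only-w : ∀ {x} → x ∈ Poor t G B? ∩ ∁ B ∪ (_≡ w) → x ∈ B → x ≡ w
      only-w (inj₁ (_ , x∉B)) x∈B = contradiction x∈B x∉B
      only-w (inj₂ x≡w)       _   = x≡w
  ... | no empty =
    let (U , U-inj , U-out) = choose outside? t t≤outside in
    U , U-inj , proj₁ ∘ U-out , λ {i} Ui∈B _ → contradiction Ui∈B (proj₂ (U-out i))
    where
    t≤outside : t ≤ count outside?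
    t≤outside = ≤-trans (≤-trans (≤-square+1 t) t²<poor)
                  (≤-trans poor≤in+out (≤-reflexive (cong (_+ count outside?) (n≤0⇒n≡0 (≮⇒≥ empty)))))
      where ≤-square+1 : ∀ t → t ≤ suc (t * t)
            ≤-square+1 zero    = z≤n
            ≤-square+1 (suc k) = s≤s (m≤n⇒m≤1+n (m≤m+n k (k * suc k)))

  poor-bound : t * t < count B? → count (poor? t G B?) ≤ t * t
  poor-bound t²<B with count (poor? t G B?) ≤? t * t
  ... | yes poor≤t² = poor≤t²
  ... | no poor≰t² with t ≤? suc (count outside?)
  ...   | yes t≤ = contradiction (poor-family (≰⇒> poor≰t²) t≤) (¬poor-family t²<B)
  ...   | no t≰ = ⊥-elim (¬many-poor-inside (begin
      t * t + 3                              ≡⟨ +-comm (t * t) 3 ⟩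
      2 + suc (t * t)                        ≤⟨ +-monoʳ-≤ 2 (≤-trans (≰⇒> poor≰t²) poor≤in+out) ⟩
      2 + (count inside? + count outside?)   ≡⟨ rearrange (count inside?) (count outside?) ⟩
      count inside? + (2 + count outside?)   ≤⟨ +-monoʳ-≤ (count inside?) (≰⇒> t≰) ⟩
      count inside? + t                      ∎))
    where
    open ≤-Reasoning
    rearrange : ∀ a b → 2 + (a + b) ≡ a + (2 + b)
    rearrange = solve-∀

-- Distance across an edge after a flip

inPart? : (P : Partition n) (A : Fin (size P)) → Decidable (λ x → part P x ≡ A)
inPart? P A x = part P x ≟ A

module _ {t} (G : Graph n) (kf : KttFree t G) (P : Partition n) (L : List (Fin (size P) × Fin (size P))) where

  private
    G′ : Adj n
    G′ = flips P L (adj G)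

    flipped-nonAdj : ∀ {a b} → flipped L (part P a) (part P b) ≡ true → NonAdj G a b → G′ a b ≡ true
    flipped-nonAdj ab-flipped (b≢a , ab) =
      flips-adjacent P (adj G) L (b≢a ∘ sym) (trans ab (cong not (sym ab-flipped)))

  flipped-dist≤3 : ∀ {u v} → flipped L (part P u) (part P v) ≡ true →
    (X Y : Fin t → Fin n) → Injective _≡_ _≡_ X → Injective _≡_ _≡_ Y →
    (∀ i → part P (X i) ≡ part P v × NonAdj G u (X i)) →
    (∀ j → part P (Y j) ≡ part P u × NonAdj G v (Y j)) →
    DistLe G′ u v 3
  flipped-dist≤3 {u} {v} uv-flipped X Y X-inj Y-inj X∈ Y∈ =
    [ via-common , via-nonAdjacent ]′ (overlap-or-nonAdjacent G kf X Y X-inj Y-inj)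
    where
    u→X : ∀ i → G′ u (X i) ≡ true
    u→X i = flipped-nonAdj (trans (cong (flipped L (part P u)) (proj₁ (X∈ i))) uv-flipped) (proj₂ (X∈ i))
    Y→v : ∀ j → G′ (Y j) v ≡ true
    Y→v j = flipped-nonAdj (trans (cong (λ a → flipped L a (part P v)) (proj₁ (Y∈ j))) uv-flipped)
                           (NonAdj-sym G (proj₂ (Y∈ j)))
    via-common : (∃₂ λ i j → X i ≡ Y j) → DistLe G′ u v 3
    via-common (i , j , Xi≡Yj) =
      2 , s≤s (s≤s z≤n) , step (u→X i) (step (subst (λ x → G′ x v ≡ true) (sym Xi≡Yj) (Y→v j)) here)
    via-nonAdjacent : (∃₂ λ i j → X i ≢ Y j × adj G (X i) (Y j) ≡ false) → DistLe G′ u v 3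
    via-nonAdjacent (i , j , Xi≢Yj , XiYj) = 3 , ≤-refl , step (u→X i) (step X→Y (step (Y→v j) here))
      where
      X→Y : G′ (X i) (Y j) ≡ true
      X→Y = flipped-nonAdj (trans (cong₂ (flipped L) (proj₁ (X∈ i)) (proj₁ (Y∈ j)))
                                  (trans (flipped-sym L (part P v) (part P u)) uv-flipped))
                           (Xi≢Yj ∘ sym , XiYj)

  edge-dist≤3 : ∀ {u v} → adj G u v ≡ true →
    t ≤ count (inPart? P (part P v) ∩? nonAdj? G u) → t ≤ count (inPart? P (part P u) ∩? nonAdj? G v) →
    DistLe G′ u v 3
  edge-dist≤3 {u} {v} uv X-many Y-many with flipped L (part P u) (part P v) in uv-flipped
  ... | false = 1 , s≤s z≤n ,
        step (flips-adjacent P (adj G) L u≢v (trans uv (cong not (sym uv-flipped)))) here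
    where u≢v : u ≢ v
          u≢v refl = contradiction (trans (sym uv) (irrefl G u)) λ ()
  ... | true =
    let (X , X-inj , X∈) = choose _ t X-many
        (Y , Y-inj , Y∈) = choose _ t Y-many
    in flipped-dist≤3 uv-flipped X Y X-inj Y-inj X∈ Y∈

-- The deleted set

module _ (t : ℕ) (G : Graph n) (P : Partition n) where

  Small : Fin (size P) → Set
  Small A = count (inPart? P A) ≤ t * t

  Removed : Fin (size P) → Pred (Fin n) 0ℓ
  Removed A x = (Small A × part P x ≡ A) ⊎ (¬ Small A × x ∈ Poor t G (inPart? P A))

  removed? : ∀ A → Decidable (Removed A)
  removed? A x = (count (inPart? P A) ≤? t * t ×-dec inPart? P A x)
              ⊎-dec (¬? (count (inPart? P A) ≤? t * t) ×-dec poor? t G (inPart? P A) x)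

  Deleted : Pred (Fin n) 0ℓ
  Deleted = ⋃ (Fin (size P)) Removed

  deleted? : Decidable Deleted
  deleted? = ⋃? removed?

  kept⇒many-nonAdj : ∀ {u v} → ¬ u ∈ Deleted → ¬ v ∈ Deleted →
                     t ≤ count (inPart? P (part P v) ∩? nonAdj? G u)
  kept⇒many-nonAdj {u} {v} u-kept v-kept with count (inPart? P (part P v)) ≤? t * t
  ... | yes small = contradiction (part P v , inj₁ (small , refl)) v-kept
  ... | no ¬small = ≮⇒≥ λ u-poor → u-kept (part P v , inj₂ (¬small , u-poor))

  count-removed : KttFree t G → ∀ A → count (removed? A) ≤ t * t
  count-removed kf A = by-size (count (inPart? P A) ≤? t * t)
    where
    by-size : Dec (Small A) → count (removed? A) ≤ t * t
    by-size (yes small) = ≤-trans (count-mono only-part (removed? A) (inPart? P A)) small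
      where only-part : Removed A ⊆ λ x → part P x ≡ A
            only-part (inj₁ (_ , x∈A))    = x∈A
            only-part (inj₂ (¬small , _)) = contradiction small ¬small
    by-size (no ¬small) = ≤-trans (count-mono only-poor (removed? A) (poor? t G (inPart? P A)))
                                  (poor-bound G kf (inPart? P A) (≰⇒> ¬small))
      where only-poor : Removed A ⊆ Poor t G (inPart? P A)
            only-poor (inj₁ (small , _))  = contradiction small ¬small
            only-poor (inj₂ (_ , x-poor)) = x-poor

lemma3p1 : ∀ {n : ℕ} (t : ℕ) (G : Graph n) → KttFree t G → (P : Partition n) →
    Σ (Subset n) λ S →
      (∣ S ∣ ≤ size P * t ^ 2) ×
      (∀ (L : List (Fin (size P) × Fin (size P))) (u v : Fin n) →
         deleteAdj (adj G) S u v ≡ true → DistLe (flips P L (adj G)) u v 3) ×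
      (∀ (L : List (Fin (size P) × Fin (size P))) (u v : Fin n) → u ∉ S → v ∉ S →
         ∀ (d : ℕ) → DistLe (deleteAdj (adj G) S) u v d →
           DistLe (flips P L (adj G)) u v (3 * d))
lemma3p1 {n} t G kf P = S , ∣S∣≤ , short-edge , λ L u v _ _ d (k , k≤d , walk) →
  let (j , j≤3k , walk′) = distLe-stretch 3 (λ {u} {v} → short-edge L u v) walk
  in j , ≤-trans j≤3k (*-monoʳ-≤ 3 k≤d) , walk′
  where
  S : Subset n
  S = tabulate (does ∘ deleted? t G P)

  ∣S∣≤ : ∣ S ∣ ≤ size P * t ^ 2
  ∣S∣≤ = begin
    ∣ S ∣                   ≡⟨ ∣tabulate∣≡count (deleted? t G P) ⟩
    count (deleted? t G P)  ≤⟨ count-⋃ (removed? t G P) (count-removed t G P kf) ⟩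
    size P * (t * t)        ≡⟨ cong (λ t² → size P * (t * t²)) (sym (*-identityʳ t)) ⟩
    size P * t ^ 2          ∎
    where open ≤-Reasoning

  deleteAdj-kept : ∀ {u v} → deleteAdj (adj G) S u v ≡ true →
                   adj G u v ≡ true × ¬ u ∈ Deleted t G P × ¬ v ∈ Deleted t G P
  deleteAdj-kept {u} {v} uv-kept
    rewrite lookup∘tabulate (does ∘ deleted? t G P) u | lookup∘tabulate (does ∘ deleted? t G P) v
    with adj G u v | deleted? t G P u | deleted? t G P v
  ... | true | no u-kept | no v-kept = refl , u-kept , v-kept

  short-edge : ∀ L u v → deleteAdj (adj G) S u v ≡ true → DistLe (flips P L (adj G)) u v 3
  short-edge L u v uv-kept =
    let (uv , u-kept , v-kept) = deleteAdj-kept uv-kept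
    in edge-dist≤3 G kf P L uv (kept⇒many-nonAdj t G P u-kept v-kept) (kept⇒many-nonAdj t G P v-kept u-kept)
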